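{- Let $\mathcal{P}_1\subseteq\mathbb{R}^2$ (coordinates $(x,z)$) be the convex quadrilateral with vertices $(0,0),(1,0),(\tfrac94,\tfrac12),(0,\tfrac87)$, and let $\mathcal{R}_1\subseteq\mathcal{P}_1$ be the triangle with vertices $r_4=(2,\tfrac12)$, $r_5=(\tfrac12,\tfrac34)$, $r_6=(\tfrac16,\tfrac{7}{12})$. Let $q_1=(u,0)$ with $0\le u\le1$. If the supporting polygon $\mathcal{S}_{q_1}$ nested between $\mathcal{R}_1$ and $\mathcal{P}_1$ has three vertices, then $u\le 2-\sqrt2$.
   Context: All polygons are convex, and orientation ("anti-clockwise", "to the left") refers to the plane with first coordinate $x$ horizontal and second coordinate $z$ vertical. Given polygons $\mathcal{R}\subseteq\mathcal{P}\subseteq\mathbb{R}^2$, a polygon $\mathcal{Q}$ is nested between $\mathcal{R}$ and $\mathcal{P}$ if $\mathcal{R}\subseteq\mathcal{Q}\subseteq\mathcal{P}$. A supporting line segment is a directed line segment $uv$ whose endpoints $u,v$ lie on the boundary of $\mathcal{P}$, such that $\mathcal{R}$ touches $uv$ and lies to the left of $uv$. A nested polygon with vertices $v_1,\dots,v_k$ listed in anti-clockwise order is supporting if the directed segments $v_1v_2,\dots,v_{k-1}v_k$ are all supporting (the segment $v_kv_1$ need not be). For a point $v_1$ on the boundary of $\mathcal{P}$, such a supporting polygon with first vertex $v_1$ is uniquely determined by $v_1$ and is denoted $\mathcal{S}_{v_1}$. -}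

module Defs where

open import Level using (0ℓ)
open import Data.Nat using (ℕ; zero; suc)
open import Data.Product using (Σ; _×_; _,_; ∃)
open import Data.List using (List; []; _∷_; _++_; [_]; zip; zipWith; length; foldr)
open import Data.List.Relation.Unary.All using (All)
open import Data.List.Relation.Unary.Any using (Any)
open import Relation.Nullary using (¬_)
open import Relation.Binary.PropositionalEquality using (_≡_)
open import Algebra.Structures using (IsCommutativeRing)
open import Relation.Binary.Structures using (IsTotalOrder)

-- The real numbers, axiomatised as a Dedekind-complete ordered field.
-- (Any such structure is isomorphic to ℝ; the statement quantifies over
-- all of them.)

record RealField : Set₁ where
  infixl 7 _*_
  infixl 6 _+_ _-_
  infix 4 _≈_ _≤_
  field
    Carrier : Set
    _≈_     : Carrier → Carrier → Set
    _+_     : Carrier → Carrier → Carrier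
    _*_     : Carrier → Carrier → Carrier
    -_      : Carrier → Carrier
    0#      : Carrier
    1#      : Carrier
    _⁻¹     : Carrier → Carrier
    _≤_     : Carrier → Carrier → Set
    isCommutativeRing : IsCommutativeRing _≈_ _+_ _*_ -_ 0# 1#
    0≉1      : ¬ (0# ≈ 1#)
    ⁻¹-cong  : ∀ {x y} → x ≈ y → x ⁻¹ ≈ y ⁻¹
    ⁻¹-inverse : ∀ x → ¬ (x ≈ 0#) → x * (x ⁻¹) ≈ 1#
    isTotalOrder : IsTotalOrder _≈_ _≤_
    +-mono-≤ : ∀ {x y} z → x ≤ y → x + z ≤ y + z
    *-nonneg : ∀ {x y} → 0# ≤ x → 0# ≤ y → 0# ≤ x * y
    sup : (S : Carrier → Set) → (∃ λ x → S x) →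
          (∃ λ b → ∀ x → S x → x ≤ b) →
          ∃ λ s → (∀ x → S x → x ≤ s) ×
                  (∀ b → (∀ x → S x → x ≤ b) → s ≤ b)

  _-_ : Carrier → Carrier → Carrier
  x - y = x + (- y)

  fromℕ : ℕ → Carrier
  fromℕ zero    = 0#
  fromℕ (suc n) = 1# + fromℕ n

  frac : ℕ → ℕ → Carrier
  frac a b = fromℕ a * (fromℕ b ⁻¹)

module Geometry (F : RealField) where
  open RealField F

  Point : Set
  Point = Carrier × Carrier

  _≈ᵖ_ : Point → Point → Set
  (a , b) ≈ᵖ (c , d) = (a ≈ c) × (b ≈ d)

  -- cross product of (a - o) and (b - o): positive iff o,a,b anticlockwise
  cross : Point → Point → Point → Carrier
  cross (ox , oz) (ax , az) (bx , bz) =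
    (ax - ox) * (bz - oz) - (az - oz) * (bx - ox)

  LeftOf : Point → Point → Point → Set
  LeftOf u v p = 0# ≤ cross u v p

  OnSegment : Point → Point → Point → Set
  OnSegment (ux , uz) (vx , vz) p =
    Σ Carrier λ t → (0# ≤ t) × (t ≤ 1#) ×
      (p ≈ᵖ (ux + t * (vx - ux) , uz + t * (vz - uz)))

  -- A convex polygon is given by its list of vertices (anticlockwise);
  -- as a region it is the convex hull of its vertices.
  Polygon : Set
  Polygon = List Point

  combination : List Carrier → List Point → Point
  combination ws vs =
    foldr (λ { (w , (x , z)) (sx , sz) → (w * x + sx , w * z + sz) })
          (0# , 0#) (zip ws vs)

  sum : List Carrier → Carrier
  sum = foldr _+_ 0#

  _∈ₚ_ : Point → Polygon → Set
  p ∈ₚ vs = Σ (List Carrier) λ ws → (length ws ≡ length vs) ×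
            All (0# ≤_) ws × (sum ws ≈ 1#) × (combination ws vs ≈ᵖ p)

  _⊆ₚ_ : Polygon → Polygon → Set
  Q ⊆ₚ P = ∀ p → p ∈ₚ Q → p ∈ₚ P

  edges : Polygon → List (Point × Point)
  edges []       = []
  edges (p ∷ ps) = zip (p ∷ ps) (ps ++ [ p ])

  OnBoundary : Polygon → Point → Set
  OnBoundary P x = Any (λ { (a , b) → OnSegment a b x }) (edges P)

  Supporting : Polygon → Polygon → Point → Point → Set
  Supporting R P u v =
    OnBoundary P u × OnBoundary P v ×
    (Σ Point λ p → p ∈ₚ R × OnSegment u v p) ×
    (∀ p → p ∈ₚ R → LeftOf u v p)

  Nested : Polygon → Polygon → Polygon → Set
  Nested R Q P = (R ⊆ₚ Q) × (Q ⊆ₚ P)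

  -- The supporting polygon S_{v₁} (nested between R and P) has exactly
  -- three vertices: there is a nested triangle v₁ v₂ v₃, vertices in
  -- anticlockwise order, with v₁v₂ and v₂v₃ supporting.  (By uniqueness
  -- of S_{v₁}, this triangle is S_{v₁}.)
  SupportingHasThreeVertices : Polygon → Polygon → Point → Set
  SupportingHasThreeVertices R P v₁ =
    Σ Point λ v₂ → Σ Point λ v₃ →
      (0# ≤ cross v₁ v₂ v₃) × ¬ (cross v₁ v₂ v₃ ≈ 0#) ×
      Nested R (v₁ ∷ v₂ ∷ v₃ ∷ []) P ×
      Supporting R P v₁ v₂ × Supporting R P v₂ v₃

  P₁ : Polygon
  P₁ = (0# , 0#) ∷ (1# , 0#) ∷ (frac 9 4 , frac 1 2) ∷ (0# , frac 8 7) ∷ []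

  r₄ r₅ r₆ : Point
  r₄ = (fromℕ 2 , frac 1 2)
  r₅ = (frac 1 2 , frac 3 4)
  r₆ = (frac 1 6 , frac 7 12)

  R₁ : Polygon
  R₁ = r₄ ∷ r₅ ∷ r₆ ∷ []

-- Write the triangle S_{q₁} as q₁ = (u , 0), v₂ = (a , b), v₃ = (c , d).  For u ≤ 1/2 there is
-- nothing to prove, since 1/2 < 2 - √2.  Otherwise, comparing x-coordinates, r₄ ∈ S_{q₁} and
-- r₆ ∈ S_{q₁} force a ≥ 2.  What remains is linear in the unknown vertices: r₄ lies left of q₁v₂,
-- r₅ left of v₂v₃, r₆ left of the closing edge v₃q₁, v₂ lies below the edge 2x + 7z = 8 of P₁,
-- and c ≥ 0.  Eliminating v₃ and then v₂ with explicit nonnegative multipliers (polynomial in u)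
-- leaves u² - 4u + 2 ≥ 0, and since u ≤ 1 this says u ≤ 2 - √2.

module Submission where

open import Defs
open import Level using (0ℓ)
open import Data.Nat as ℕ using (ℕ; zero; suc)
open import Data.Integer as ℤ using (ℤ; +_; -[1+_])
import Data.Integer.Properties as ℤ
import Data.Nat.Properties as ℕ
open import Data.Sign as Sign using ()
open import Data.Maybe using (Maybe; just; nothing)
open import Data.Product using (_×_; _,_; proj₁; proj₂)
open import Data.List using (List; []; _∷_; length; map)
open import Data.List.Relation.Unary.All as All using (All; []; _∷_)
open import Data.List.Relation.Unary.Any using (here; there)
open import Data.List.Membership.Propositional using (_∈_)
import Data.List.Properties as List
open import Data.Sum using (inj₁; inj₂; [_,_]′)
open import Data.Empty using (⊥-elim)
open import Relation.Nullary using (¬_; yes; no)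
open import Relation.Binary.PropositionalEquality as ≡ using (_≡_)
open import Relation.Binary.Structures using (IsTotalOrder)
open import Algebra.Bundles using (CommutativeRing)
import Algebra.Solver.Ring.AlmostCommutativeRing as ACR

module RealFieldProperties (F : RealField) where
  open RealField F public

  commutativeRing : CommutativeRing 0ℓ 0ℓ
  commutativeRing = record { isCommutativeRing = isCommutativeRing }

  open CommutativeRing commutativeRing public
    using (setoid; ring; distribʳ; *-identityˡ; +-assoc; +-comm; +-identityˡ; +-identityʳ; -‿inverseʳ;
           *-assoc; *-comm; *-identityʳ; zeroˡ; zeroʳ; +-cong; -‿cong; +-congˡ; +-congʳ; *-congˡ; *-congʳ)
    renaming (refl to ≈-refl; sym to ≈-sym; trans to ≈-trans; reflexive to ≈-reflexive)
  open import Algebra.Properties.Ring ring public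
    using (-‿distribˡ-*; -‿distribʳ-*; -0#≈0#; -‿involutive; -‿+-comm; xyx⁻¹≈y)
  open IsTotalOrder isTotalOrder public
    using (total; antisym; ≲-respʳ-≈) renaming (trans to ≤-trans; reflexive to ≤-reflexive)
  open import Relation.Binary.Reasoning.Setoid setoid

  fromℕ-+ : ∀ m n → fromℕ (m ℕ.+ n) ≈ fromℕ m + fromℕ n
  fromℕ-+ zero    n = ≈-sym (+-identityˡ _)
  fromℕ-+ (suc m) n = ≈-trans (+-congˡ (fromℕ-+ m n)) (≈-sym (+-assoc _ _ _))

  fromℕ-* : ∀ m n → fromℕ (m ℕ.* n) ≈ fromℕ m * fromℕ n
  fromℕ-* zero    n = ≈-sym (zeroˡ _)
  fromℕ-* (suc m) n = begin
    fromℕ (n ℕ.+ m ℕ.* n)             ≈⟨ fromℕ-+ n (m ℕ.* n) ⟩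
    fromℕ n + fromℕ (m ℕ.* n)         ≈⟨ +-cong (≈-sym (*-identityˡ _)) (fromℕ-* m n) ⟩
    1# * fromℕ n + fromℕ m * fromℕ n  ≈⟨ distribʳ _ _ _ ⟨
    (1# + fromℕ m) * fromℕ n          ∎

  ⟦_⟧ℤ : ℤ → Carrier
  ⟦ + n ⟧ℤ     = fromℕ n
  ⟦ -[1+ n ] ⟧ℤ = - fromℕ (suc n)

  ⊖-homo : ∀ m n → ⟦ m ℤ.⊖ n ⟧ℤ ≈ fromℕ m - fromℕ n
  ⊖-homo zero    zero    = ≈-sym (≈-trans (+-congˡ -0#≈0#) (+-identityʳ 0#))
  ⊖-homo zero    (suc n) = ≈-sym (+-identityˡ _)
  ⊖-homo (suc m) zero    = ≈-sym (≈-trans (+-congˡ -0#≈0#) (+-identityʳ _))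
  ⊖-homo (suc m) (suc n) = begin
    ⟦ suc m ℤ.⊖ suc n ⟧ℤ         ≡⟨ ≡.cong ⟦_⟧ℤ (ℤ.[1+m]⊖[1+n]≡m⊖n m n) ⟩
    ⟦ m ℤ.⊖ n ⟧ℤ                 ≈⟨ ⊖-homo m n ⟩
    fromℕ m - fromℕ n            ≈⟨ +-shift-cancel 1# (fromℕ m) (fromℕ n) ⟨
    (1# + fromℕ m) - (1# + fromℕ n) ∎
    where
    +-shift-cancel : ∀ x y z → (x + y) - (x + z) ≈ y - z
    +-shift-cancel x y z = begin
      (x + y) - (x + z)     ≈⟨ +-congˡ (-‿+-comm x z) ⟨
      (x + y) + (- x - z)   ≈⟨ +-assoc (x + y) (- x) (- z) ⟨
      (x + y) - x - z       ≈⟨ +-congʳ (xyx⁻¹≈y x y) ⟩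
      y - z                 ∎

  neg-homo : ∀ i → ⟦ ℤ.- i ⟧ℤ ≈ - ⟦ i ⟧ℤ
  neg-homo (+ zero)  = ≈-sym -0#≈0#
  neg-homo (+ suc n) = ≈-refl
  neg-homo -[1+ n ]  = ≈-sym (-‿involutive _)

  +-homo : ∀ i j → ⟦ i ℤ.+ j ⟧ℤ ≈ ⟦ i ⟧ℤ + ⟦ j ⟧ℤ
  +-homo (+ m)    (+ n)    = fromℕ-+ m n
  +-homo (+ m)    -[1+ n ] = ⊖-homo m (suc n)
  +-homo -[1+ m ] (+ n)    = ≈-trans (⊖-homo n (suc m)) (+-comm _ _)
  +-homo -[1+ m ] -[1+ n ] = begin
    - fromℕ (suc (suc (m ℕ.+ n)))        ≡⟨ ≡.cong (λ k → - fromℕ (suc k)) (ℕ.+-suc m n) ⟨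
    - fromℕ (suc m ℕ.+ suc n)            ≈⟨ -‿cong (fromℕ-+ (suc m) (suc n)) ⟩
    - (fromℕ (suc m) + fromℕ (suc n))    ≈⟨ -‿+-comm _ _ ⟨
    - fromℕ (suc m) + - fromℕ (suc n)    ∎

  +◃-homo : ∀ n → ⟦ Sign.+ ℤ.◃ n ⟧ℤ ≈ fromℕ n
  +◃-homo n = ≈-reflexive (≡.cong ⟦_⟧ℤ (ℤ.+◃n≡+n n))

  -◃-homo : ∀ n → ⟦ Sign.- ℤ.◃ n ⟧ℤ ≈ - fromℕ n
  -◃-homo n = ≈-trans (≈-reflexive (≡.cong ⟦_⟧ℤ (ℤ.-◃n≡-n n))) (neg-homo (+ n))

  *-homo : ∀ i j → ⟦ i ℤ.* j ⟧ℤ ≈ ⟦ i ⟧ℤ * ⟦ j ⟧ℤ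
  *-homo (+ m) (+ n) = ≈-trans (+◃-homo (m ℕ.* n)) (fromℕ-* m n)
  *-homo (+ m) -[1+ n ] = begin
    ⟦ Sign.- ℤ.◃ m ℕ.* suc n ⟧ℤ     ≈⟨ -◃-homo (m ℕ.* suc n) ⟩
    - fromℕ (m ℕ.* suc n)          ≈⟨ -‿cong (fromℕ-* m (suc n)) ⟩
    - (fromℕ m * fromℕ (suc n))    ≈⟨ -‿distribʳ-* _ _ ⟩
    fromℕ m * - fromℕ (suc n)      ∎
  *-homo -[1+ m ] (+ n) = begin
    ⟦ Sign.- ℤ.◃ suc m ℕ.* n ⟧ℤ     ≈⟨ -◃-homo (suc m ℕ.* n) ⟩
    - fromℕ (suc m ℕ.* n)          ≈⟨ -‿cong (fromℕ-* (suc m) n) ⟩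
    - (fromℕ (suc m) * fromℕ n)    ≈⟨ -‿distribˡ-* _ _ ⟩
    - fromℕ (suc m) * fromℕ n      ∎
  *-homo -[1+ m ] -[1+ n ] = begin
    ⟦ Sign.+ ℤ.◃ suc m ℕ.* suc n ⟧ℤ      ≈⟨ +◃-homo (suc m ℕ.* suc n) ⟩
    fromℕ (suc m ℕ.* suc n)             ≈⟨ fromℕ-* (suc m) (suc n) ⟩
    fromℕ (suc m) * fromℕ (suc n)       ≈⟨ -‿involutive _ ⟨
    - - (fromℕ (suc m) * fromℕ (suc n)) ≈⟨ -‿cong (-‿distribʳ-* _ _) ⟩
    - (fromℕ (suc m) * - fromℕ (suc n)) ≈⟨ -‿distribˡ-* _ _ ⟩
    - fromℕ (suc m) * - fromℕ (suc n)   ∎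

  ℤ-morphism : ℤ.+-*-rawRing ACR.-Raw-AlmostCommutative⟶ ACR.fromCommutativeRing commutativeRing
  ℤ-morphism = record
    { ⟦_⟧ = ⟦_⟧ℤ ; +-homo = +-homo ; *-homo = *-homo ; -‿homo = neg-homo
    ; 0-homo = ≈-refl ; 1-homo = +-identityʳ 1# }

  ℤ-equality : ∀ i j → Maybe (⟦ i ⟧ℤ ≈ ⟦ j ⟧ℤ)
  ℤ-equality i j with i ℤ.≟ j
  ... | yes i≡j = just (≈-reflexive (≡.cong ⟦_⟧ℤ i≡j))
  ... | no _    = nothing

  open import Algebra.Solver.Ring ℤ.+-*-rawRing (ACR.fromCommutativeRing commutativeRing) ℤ-morphism ℤ-equality public

  κ : ∀ {n} → ℕ → Polynomial n
  κ m = con (+ m)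

  x≤y⇒0≤y-x : ∀ {x y} → x ≤ y → 0# ≤ y - x
  x≤y⇒0≤y-x {x} h = ≤-trans (≤-reflexive (≈-sym (-‿inverseʳ x))) (+-mono-≤ (- x) h)

  0≤y-x⇒x≤y : ∀ {x y} → 0# ≤ y - x → x ≤ y
  0≤y-x⇒x≤y {x} {y} h = ≤-trans (≤-reflexive (≈-sym (+-identityˡ x)))
    (≲-respʳ-≈ (solve 2 (λ x y → (y :- x) :+ x := y) ≈-refl x y) (+-mono-≤ x h))

  +-nonneg : ∀ {x y} → 0# ≤ x → 0# ≤ y → 0# ≤ x + y
  +-nonneg {x} {y} 0≤x 0≤y = ≤-trans 0≤y (≤-trans (≤-reflexive (≈-sym (+-identityˡ y))) (+-mono-≤ y 0≤x))

  nonneg∧nonpos⇒≈0 : ∀ {x} → 0# ≤ x → 0# ≤ - x → x ≈ 0#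
  nonneg∧nonpos⇒≈0 {x} 0≤x 0≤-x = antisym (0≤y-x⇒x≤y (≲-respʳ-≈ (≈-sym (+-identityˡ (- x))) 0≤-x)) 0≤x

  0≤1 : 0# ≤ 1#
  0≤1 with total 0# 1#
  ... | inj₁ 0≤1 = 0≤1
  ... | inj₂ 1≤0 = ≲-respʳ-≈ (≈-trans (solve 1 (λ o → (:- o) :* (:- o) := o :* o) ≈-refl 1#) (*-identityʳ 1#))
                              (*-nonneg 0≤-1 0≤-1)
    where
    0≤-1 : 0# ≤ - 1#
    0≤-1 = ≲-respʳ-≈ (+-identityˡ (- 1#)) (x≤y⇒0≤y-x 1≤0)

  fromℕ-nonneg : ∀ n → 0# ≤ fromℕ n
  fromℕ-nonneg zero    = ≤-reflexive ≈-refl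
  fromℕ-nonneg (suc n) = +-nonneg 0≤1 (fromℕ-nonneg n)

  ⟦⟧ℤ-nonneg : ∀ {i} → + 0 ℤ.≤ i → 0# ≤ ⟦ i ⟧ℤ
  ⟦⟧ℤ-nonneg {+ n} _ = fromℕ-nonneg n

  -fromℕ-suc≱0 : ∀ n → ¬ (0# ≤ - fromℕ (suc n))
  -fromℕ-suc≱0 n 0≤-[1+n] = 0≉1 (antisym 0≤1 1≤0)
    where
    0≤-1 : 0# ≤ - 1#
    0≤-1 = ≲-respʳ-≈ (solve 2 (λ o m → :- (o :+ m) :+ m := :- o) ≈-refl 1# (fromℕ n))
             (+-nonneg 0≤-[1+n] (fromℕ-nonneg n))
    1≤0 : 1# ≤ 0#
    1≤0 = 0≤y-x⇒x≤y (≲-respʳ-≈ (≈-sym (+-identityˡ (- 1#))) 0≤-1)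

  nonneg+fromℕ-suc≉0 : ∀ {x} n → 0# ≤ x → ¬ (x + fromℕ (suc n) ≈ 0#)
  nonneg+fromℕ-suc≉0 {x} n 0≤x x+N≈0 = -fromℕ-suc≱0 n (≲-respʳ-≈ x≈-N 0≤x)
    where
    N = fromℕ (suc n)
    x≈-N : x ≈ - N
    x≈-N = begin
      x            ≈⟨ solve 2 (λ x N → x := (x :+ N) :- N) ≈-refl x N ⟩
      (x + N) - N  ≈⟨ +-congʳ x+N≈0 ⟩
      0# - N       ≈⟨ +-identityˡ (- N) ⟩
      - N          ∎

  fromℕ-suc≉0 : ∀ n → ¬ (fromℕ (suc n) ≈ 0#)
  fromℕ-suc≉0 n N≈0 = nonneg+fromℕ-suc≉0 n (≤-reflexive ≈-refl) (≈-trans (+-identityˡ _) N≈0)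

  *-cancelʳ-nonneg : ∀ {x y} → 0# ≤ y → ¬ (y ≈ 0#) → 0# ≤ x * y → 0# ≤ x
  *-cancelʳ-nonneg {x} {y} 0≤y y≉0 0≤xy with total 0# x
  ... | inj₁ 0≤x = 0≤x
  ... | inj₂ x≤0 = ≤-reflexive (≈-sym x≈0)
    where
    0≤-x : 0# ≤ - x
    0≤-x = ≲-respʳ-≈ (+-identityˡ (- x)) (x≤y⇒0≤y-x x≤0)
    xy≈0 : x * y ≈ 0#
    xy≈0 = nonneg∧nonpos⇒≈0 0≤xy (≲-respʳ-≈ (≈-sym (-‿distribˡ-* x y)) (*-nonneg 0≤-x 0≤y))
    x≈0 : x ≈ 0#
    x≈0 = begin
      x                ≈⟨ *-identityʳ x ⟨
      x * 1#           ≈⟨ *-congˡ (⁻¹-inverse y y≉0) ⟨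
      x * (y * y ⁻¹)   ≈⟨ *-assoc x y (y ⁻¹) ⟨
      (x * y) * y ⁻¹   ≈⟨ *-congʳ xy≈0 ⟩
      0# * y ⁻¹        ≈⟨ zeroˡ (y ⁻¹) ⟩
      0#               ∎

  *-cancelˡ-nonneg : ∀ {x y} → 0# ≤ y → ¬ (y ≈ 0#) → 0# ≤ y * x → 0# ≤ x
  *-cancelˡ-nonneg 0≤y y≉0 0≤yx = *-cancelʳ-nonneg 0≤y y≉0 (≲-respʳ-≈ (*-comm _ _) 0≤yx)

  fromℕ-suc-*-cancel : ∀ {x} n → 0# ≤ fromℕ (suc n) * x → 0# ≤ x
  fromℕ-suc-*-cancel n = *-cancelˡ-nonneg (fromℕ-nonneg (suc n)) (fromℕ-suc≉0 n)

  private
    2-s²≈0 : ∀ {s} → s * s ≈ fromℕ 2 → fromℕ 2 - s * s ≈ 0#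
    2-s²≈0 {s} s²≈2 = ≈-trans (+-congˡ (-‿cong s²≈2)) (-‿inverseʳ (fromℕ 2))

  2u≤1⇒u≤2-√2 : ∀ {u s} → 0# ≤ s → s * s ≈ fromℕ 2 → 0# ≤ fromℕ 1 - fromℕ 2 * u → u ≤ fromℕ 2 - s
  2u≤1⇒u≤2-√2 {u} {s} 0≤s s²≈2 0≤1-2u =
    0≤y-x⇒x≤y (fromℕ-suc-*-cancel 1 (≲-respʳ-≈ twice (+-nonneg 0≤3-2s 0≤1-2u)))
    where
    twice : (fromℕ 3 - fromℕ 2 * s) + (fromℕ 1 - fromℕ 2 * u) ≈ fromℕ 2 * (fromℕ 2 - s - u)
    twice = solve 2 (λ u s → (κ 3 :- κ 2 :* s) :+ (κ 1 :- κ 2 :* u)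
                          := κ 2 :* (κ 2 :- s :- u)) ≈-refl u s
    conjugates : (fromℕ 3 - fromℕ 2 * s) * (fromℕ 2 * s + fromℕ 3) ≈ fromℕ 1
    conjugates = begin
      (fromℕ 3 - fromℕ 2 * s) * (fromℕ 2 * s + fromℕ 3)
        ≈⟨ solve 1 (λ s → (κ 3 :- κ 2 :* s) :* (κ 2 :* s :+ κ 3)
                        := κ 1 :+ κ 4 :* (κ 2 :- s :* s)) ≈-refl s ⟩
      fromℕ 1 + fromℕ 4 * (fromℕ 2 - s * s)  ≈⟨ +-congˡ (≈-trans (*-congˡ (2-s²≈0 s²≈2)) (zeroʳ _)) ⟩
      fromℕ 1 + 0#                            ≈⟨ +-identityʳ _ ⟩
      fromℕ 1                                 ∎
    0≤3-2s : 0# ≤ fromℕ 3 - fromℕ 2 * s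
    0≤3-2s = *-cancelʳ-nonneg (+-nonneg (*-nonneg (fromℕ-nonneg 2) 0≤s) (fromℕ-nonneg 3))
               (nonneg+fromℕ-suc≉0 2 (*-nonneg (fromℕ-nonneg 2) 0≤s))
               (≲-respʳ-≈ (≈-sym conjugates) (fromℕ-nonneg 1))

  u²-4u+2≥0⇒u≤2-√2 : ∀ {u s} → 0# ≤ s → s * s ≈ fromℕ 2 → 0# ≤ fromℕ 1 - u →
                     0# ≤ u * u - fromℕ 4 * u + fromℕ 2 → u ≤ fromℕ 2 - s
  u²-4u+2≥0⇒u≤2-√2 {u} {s} 0≤s s²≈2 0≤1-u 0≤u²-4u+2 =
    0≤y-x⇒x≤y (*-cancelʳ-nonneg (+-nonneg 0≤1-u+s (fromℕ-nonneg 1)) (nonneg+fromℕ-suc≉0 0 0≤1-u+s)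
                 (≲-respʳ-≈ (≈-sym factorisation) 0≤u²-4u+2))
    where
    0≤1-u+s : 0# ≤ fromℕ 1 - u + s
    0≤1-u+s = +-nonneg 0≤1-u 0≤s
    factorisation : (fromℕ 2 - s - u) * ((fromℕ 1 - u + s) + fromℕ 1) ≈ u * u - fromℕ 4 * u + fromℕ 2
    factorisation = begin
      (fromℕ 2 - s - u) * ((fromℕ 1 - u + s) + fromℕ 1)
        ≈⟨ solve 2 (λ u s → (κ 2 :- s :- u) :* ((κ 1 :- u :+ s) :+ κ 1)
                        := (u :* u :- κ 4 :* u :+ κ 2) :+ (κ 2 :- s :* s)) ≈-refl u s ⟩
      (u * u - fromℕ 4 * u + fromℕ 2) + (fromℕ 2 - s * s)  ≈⟨ +-congˡ (2-s²≈0 s²≈2) ⟩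
      (u * u - fromℕ 4 * u + fromℕ 2) + 0#                 ≈⟨ +-identityʳ _ ⟩
      u * u - fromℕ 4 * u + fromℕ 2                        ∎

module ConvexGeometry (F : RealField) where
  open RealFieldProperties F
  open Geometry F
  open import Relation.Binary.Reasoning.Setoid setoid

  affine : Carrier → Carrier → Carrier → Point → Carrier
  affine α β γ (x , z) = α * x + β * z + γ

  affine-cong : ∀ {α β γ p q} → p ≈ᵖ q → affine α β γ p ≈ affine α β γ q
  affine-cong (x≈ , z≈) = +-congʳ (+-cong (*-congˡ x≈) (*-congˡ z≈))

  -- Homogenised in the weights, so that the induction needs no Σ ws ≈ 1.
  cone-nonneg : ∀ {α β γ} ws vs → length ws ≡ length vs → All (0# ≤_) ws → All (λ v → 0# ≤ affine α β γ v) vs →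
                let (x , z) = combination ws vs in 0# ≤ α * x + β * z + γ * sum ws
  cone-nonneg []       []             _   _          _          =
    ≤-reflexive (solve 3 (λ α β γ → κ 0 := α :* κ 0 :+ β :* κ 0 :+ γ :* κ 0) ≈-refl _ _ _)
  cone-nonneg {α} {β} {γ} (w ∷ ws) ((x , z) ∷ vs) len (0≤w ∷ ws≥0) (0≤v ∷ vs≥0) =
    ≲-respʳ-≈ (solve 9 (λ α β γ w x z cx cz S →
                 w :* (α :* x :+ β :* z :+ γ) :+ (α :* cx :+ β :* cz :+ γ :* S)
              := α :* (w :* x :+ cx) :+ β :* (w :* z :+ cz) :+ γ :* (w :+ S))
              ≈-refl α β γ w x z (proj₁ c) (proj₂ c) (sum ws))
      (+-nonneg (*-nonneg 0≤w 0≤v) (cone-nonneg ws vs (ℕ.suc-injective len) ws≥0 vs≥0))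
    where c = combination ws vs

  hull-nonneg : ∀ {α β γ vs p} → All (λ v → 0# ≤ affine α β γ v) vs → p ∈ₚ vs → 0# ≤ affine α β γ p
  hull-nonneg {α} {β} {γ} {vs} {p} vs≥0 (ws , len , ws≥0 , Σws≈1 , c≈p) =
    ≲-respʳ-≈ (begin
      α * proj₁ c + β * proj₂ c + γ * sum ws  ≈⟨ +-congˡ (≈-trans (*-congˡ Σws≈1) (*-identityʳ γ)) ⟩
      affine α β γ c                          ≈⟨ affine-cong c≈p ⟩
      affine α β γ p                          ∎)
      (cone-nonneg ws vs len ws≥0 vs≥0)
    where c = combination ws vs

  hull-nonneg-≈ : ∀ {f : Point → Carrier} {α β γ vs p} → (∀ v → f v ≈ affine α β γ v) →
                  All (λ v → 0# ≤ f v) vs → p ∈ₚ vs → 0# ≤ f p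
  hull-nonneg-≈ {p = p} f≈affine vs≥0 p∈vs =
    ≲-respʳ-≈ (≈-sym (f≈affine p)) (hull-nonneg (All.map (λ {v} → ≲-respʳ-≈ (f≈affine v)) vs≥0) p∈vs)

  private
    zeros : List Point → List Carrier
    zeros = map (λ _ → 0#)

    sum-zeros : ∀ vs → sum (zeros vs) ≈ 0#
    sum-zeros []       = ≈-refl
    sum-zeros (_ ∷ vs) = ≈-trans (+-identityˡ _) (sum-zeros vs)

    combination-zeros : ∀ vs → combination (zeros vs) vs ≈ᵖ (0# , 0#)
    combination-zeros []             = ≈-refl , ≈-refl
    combination-zeros ((x , z) ∷ vs) =
      let (cx≈0 , cz≈0) = combination-zeros vs
      in ≈-trans (+-cong (zeroˡ x) cx≈0) (+-identityʳ 0#) , ≈-trans (+-cong (zeroˡ z) cz≈0) (+-identityʳ 0#)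

    zeros-nonneg : ∀ vs → All (0# ≤_) (zeros vs)
    zeros-nonneg []       = []
    zeros-nonneg (_ ∷ vs) = ≤-reflexive ≈-refl ∷ zeros-nonneg vs

  ∈⇒∈ₚ : ∀ {v vs} → v ∈ vs → v ∈ₚ vs
  ∈⇒∈ₚ {x , z} (here {xs = vs} ≡.refl) =
      1# ∷ zeros vs
    , ≡.cong suc (List.length-map _ vs)
    , 0≤1 ∷ zeros-nonneg vs
    , ≈-trans (+-congˡ (sum-zeros vs)) (+-identityʳ 1#)
    , (let (cx≈0 , cz≈0) = combination-zeros vs
       in ≈-trans (+-cong (*-identityˡ x) cx≈0) (+-identityʳ x)
        , ≈-trans (+-cong (*-identityˡ z) cz≈0) (+-identityʳ z))
  ∈⇒∈ₚ {x , z} (there {x = w} v∈vs) =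
    let (ws , len , ws≥0 , Σws≈1 , (cx≈x , cz≈z)) = ∈⇒∈ₚ v∈vs
    in  0# ∷ ws
      , ≡.cong suc len
      , ≤-reflexive ≈-refl ∷ ws≥0
      , ≈-trans (+-identityˡ _) Σws≈1
      , ≈-trans (+-cong (zeroˡ (proj₁ w)) cx≈x) (+-identityˡ x)
      , ≈-trans (+-cong (zeroˡ (proj₂ w)) cz≈z) (+-identityˡ z)

  cross≈affine : ∀ ox oz ax az p →
                 cross (ox , oz) (ax , az) p ≈ affine (- (az - oz)) (ax - ox) ((az - oz) * ox - (ax - ox) * oz) p
  cross≈affine ox oz ax az (px , pz) =
    solve 6 (λ ox oz ax az px pz →
         (ax :- ox) :* (pz :- oz) :- (az :- oz) :* (px :- ox)
      := (:- (az :- oz)) :* px :+ (ax :- ox) :* pz :+ ((az :- oz) :* ox :- (ax :- ox) :* oz))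
      ≈-refl ox oz ax az px pz

  LeftOf-hull : ∀ {o a vs p} → All (LeftOf o a) vs → p ∈ₚ vs → LeftOf o a p
  LeftOf-hull {ox , oz} {ax , az} = hull-nonneg-≈ (cross≈affine ox oz ax az)

  hull-x≤ : ∀ {m vs p} → All (λ v → proj₁ v ≤ m) vs → p ∈ₚ vs → proj₁ p ≤ m
  hull-x≤ {m} bounded p∈vs =
    0≤y-x⇒x≤y (hull-nonneg-≈ m-x≈affine (All.map x≤y⇒0≤y-x bounded) p∈vs)
    where
    m-x≈affine : ∀ v → m - proj₁ v ≈ affine (- fromℕ 1) 0# m v
    m-x≈affine (x , z) = solve 3 (λ m x z → m :- x := (:- κ 1) :* x :+ κ 0 :* z :+ m) ≈-refl m x z

  hull-x≥ : ∀ {m vs p} → All (λ v → m ≤ proj₁ v) vs → p ∈ₚ vs → m ≤ proj₁ p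
  hull-x≥ {m} bounded p∈vs =
    0≤y-x⇒x≤y (hull-nonneg-≈ x-m≈affine (All.map x≤y⇒0≤y-x bounded) p∈vs)
    where
    x-m≈affine : ∀ v → proj₁ v - m ≈ affine (fromℕ 1) 0# (- m) v
    x-m≈affine (x , z) = solve 3 (λ m x z → x :- m := κ 1 :* x :+ κ 0 :* z :- m) ≈-refl m x z

  hull-z≥ : ∀ {m vs p} → All (λ v → m ≤ proj₂ v) vs → p ∈ₚ vs → m ≤ proj₂ p
  hull-z≥ {m} bounded p∈vs =
    0≤y-x⇒x≤y (hull-nonneg-≈ z-m≈affine (All.map x≤y⇒0≤y-x bounded) p∈vs)
    where
    z-m≈affine : ∀ v → proj₂ v - m ≈ affine 0# (fromℕ 1) (- m) v
    z-m≈affine (x , z) = solve 3 (λ m x z → z :- m := κ 0 :* x :+ κ 1 :* z :- m) ≈-refl m x z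

  anticlockwise⇒LeftOf-edge₃₁ : ∀ {v₁ v₂ v₃ p} → 0# ≤ cross v₁ v₂ v₃ →
                                p ∈ₚ (v₁ ∷ v₂ ∷ v₃ ∷ []) → LeftOf v₃ v₁ p
  anticlockwise⇒LeftOf-edge₃₁ {v₁} {x₂ , z₂} {v₃} anticlockwise =
    LeftOf-hull (at-end v₃ v₁ ∷ ≲-respʳ-≈ (rotate v₁ v₃) anticlockwise ∷ at-start v₃ v₁ ∷ [])
    where
    at-start : ∀ o a → LeftOf o a o
    at-start (ox , oz) (ax , az) = ≤-reflexive (≈-sym (solve 4 (λ ox oz ax az →
      (ax :- ox) :* (oz :- oz) :- (az :- oz) :* (ox :- ox) := κ 0) ≈-refl ox oz ax az))
    at-end : ∀ o a → LeftOf o a a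
    at-end (ox , oz) (ax , az) = ≤-reflexive (≈-sym (solve 4 (λ ox oz ax az →
      (ax :- ox) :* (az :- oz) :- (az :- oz) :* (ax :- ox) := κ 0) ≈-refl ox oz ax az))
    rotate : ∀ v₁ v₃ → cross v₁ (x₂ , z₂) v₃ ≈ cross v₃ v₁ (x₂ , z₂)
    rotate (x₁ , z₁) (x₃ , z₃) = solve 6 (λ x₁ z₁ x₂ z₂ x₃ z₃ →
         (x₂ :- x₁) :* (z₃ :- z₁) :- (z₂ :- z₁) :* (x₃ :- x₁)
      := (x₁ :- x₃) :* (z₂ :- z₃) :- (z₁ :- z₃) :* (x₂ :- x₃)) ≈-refl x₁ z₁ x₂ z₂ x₃ z₃

  infix 4 _≐_/_
  record _≐_/_ (p : Point) (XZ : ℕ × ℕ) (k : ℕ) : Set where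
    constructor cleared
    field
      x-cleared : fromℕ k * proj₁ p ≈ fromℕ (proj₁ XZ)
      z-cleared : fromℕ k * proj₂ p ≈ fromℕ (proj₂ XZ)
  open _≐_/_ public

  fromℕ-*-fromℕ : ∀ k a {X} → k ℕ.* a ≡ X → fromℕ k * fromℕ a ≈ fromℕ X
  fromℕ-*-fromℕ k a ≡.refl = ≈-sym (fromℕ-* k a)

  fromℕ-*-frac : ∀ k a n X → k ℕ.* a ≡ X ℕ.* suc n → fromℕ k * frac a (suc n) ≈ fromℕ X
  fromℕ-*-frac k a n X ka≡Xn = begin
    fromℕ k * (fromℕ a * N ⁻¹)   ≈⟨ *-assoc (fromℕ k) (fromℕ a) (N ⁻¹) ⟨
    fromℕ k * fromℕ a * N ⁻¹     ≈⟨ *-congʳ (fromℕ-*-fromℕ k a ka≡Xn) ⟩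
    fromℕ (X ℕ.* suc n) * N ⁻¹   ≈⟨ *-congʳ (fromℕ-* X (suc n)) ⟩
    fromℕ X * N * N ⁻¹           ≈⟨ *-assoc (fromℕ X) N (N ⁻¹) ⟩
    fromℕ X * (N * N ⁻¹)         ≈⟨ *-congˡ (⁻¹-inverse N (fromℕ-suc≉0 n)) ⟩
    fromℕ X * 1#                 ≈⟨ *-identityʳ (fromℕ X) ⟩
    fromℕ X                      ∎
    where N = fromℕ (suc n)

  frac-nonneg : ∀ a n → 0# ≤ frac a (suc n)
  frac-nonneg a n =
    fromℕ-suc-*-cancel n (≲-respʳ-≈ (≈-sym (fromℕ-*-frac (suc n) a n a (ℕ.*-comm (suc n) a))) (fromℕ-nonneg a))

  cross-cleared : ∀ {k X Z ox oz ax az} p → p ≐ (X , Z) / k →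
                  fromℕ k * cross (ox , oz) (ax , az) p
                    ≈ (ax - ox) * (fromℕ Z - fromℕ k * oz) - (az - oz) * (fromℕ X - fromℕ k * ox)
  cross-cleared {k} {X} {Z} {ox} {oz} {ax} {az} (px , pz) (cleared kpx≈X kpz≈Z) = begin
    K * ((ax - ox) * (pz - oz) - (az - oz) * (px - ox))
      ≈⟨ solve 7 (λ K ox oz ax az px pz →
              K :* ((ax :- ox) :* (pz :- oz) :- (az :- oz) :* (px :- ox))
           := (ax :- ox) :* (K :* pz :- K :* oz) :- (az :- oz) :* (K :* px :- K :* ox)) ≈-refl K ox oz ax az px pz ⟩
    (ax - ox) * (K * pz - K * oz) - (az - oz) * (K * px - K * ox)
      ≈⟨ +-cong (*-congˡ (+-congʳ kpz≈Z)) (-‿cong (*-congˡ (+-congʳ kpx≈X))) ⟩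
    (ax - ox) * (fromℕ Z - K * oz) - (az - oz) * (fromℕ X - K * ox) ∎
    where K = fromℕ k

  LeftOf-cleared : ∀ {k X Z ox oz ax az} p → p ≐ (X , Z) / k → LeftOf (ox , oz) (ax , az) p →
                   0# ≤ (ax - ox) * (fromℕ Z - fromℕ k * oz) - (az - oz) * (fromℕ X - fromℕ k * ox)
  LeftOf-cleared {k} {X} {Z} p p≐ left = ≲-respʳ-≈ (cross-cleared {k} {X} {Z} p p≐) (*-nonneg (fromℕ-nonneg k) left)

  affine-cleared-nonneg : ∀ {k X Z α β γ} p → p ≐ (X , Z) / suc k →
                          0# ≤ α * fromℕ X + β * fromℕ Z + fromℕ (suc k) * γ → 0# ≤ affine α β γ p
  affine-cleared-nonneg {k} {X} {Z} {α} {β} {γ} (x , z) (cleared kx≈X kz≈Z) 0≤cleared =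
    fromℕ-suc-*-cancel k (≲-respʳ-≈ (≈-sym (begin
      K * (α * x + β * z + γ)
        ≈⟨ solve 6 (λ K α β γ x z → K :* (α :* x :+ β :* z :+ γ) := α :* (K :* x) :+ β :* (K :* z) :+ K :* γ)
                   ≈-refl K α β γ x z ⟩
      α * (K * x) + β * (K * z) + K * γ
        ≈⟨ +-congʳ (+-cong (*-congˡ kx≈X) (*-congˡ kz≈Z)) ⟩
      α * fromℕ X + β * fromℕ Z + K * γ ∎)) 0≤cleared)
    where K = fromℕ (suc k)

  affine-ℤ-nonneg : ∀ (α β γ : ℤ) {k X Z} p → p ≐ (X , Z) / suc k →
                    + 0 ℤ.≤ α ℤ.* + X ℤ.+ β ℤ.* + Z ℤ.+ + suc k ℤ.* γ →
                    0# ≤ affine ⟦ α ⟧ℤ ⟦ β ⟧ℤ ⟦ γ ⟧ℤ p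
  affine-ℤ-nonneg α β γ {k} {X} {Z} p p≐ 0≤cleared =
    affine-cleared-nonneg {k} {X} {Z} p p≐ (≲-respʳ-≈ homomorphic (⟦⟧ℤ-nonneg 0≤cleared))
    where
    homomorphic : ⟦ α ℤ.* + X ℤ.+ β ℤ.* + Z ℤ.+ + suc k ℤ.* γ ⟧ℤ
                  ≈ ⟦ α ⟧ℤ * fromℕ X + ⟦ β ⟧ℤ * fromℕ Z + fromℕ (suc k) * ⟦ γ ⟧ℤ
    homomorphic = ≈-trans (+-homo (α ℤ.* + X ℤ.+ β ℤ.* + Z) (+ suc k ℤ.* γ))
                    (+-cong (≈-trans (+-homo (α ℤ.* + X) (β ℤ.* + Z)) (+-cong (*-homo α (+ X)) (*-homo β (+ Z))))
                            (*-homo (+ suc k) γ))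

module SupportingTriangle (F : RealField) where
  open RealFieldProperties F
  open Geometry F
  open ConvexGeometry F
  open import Relation.Binary.Reasoning.Setoid setoid

  r₄≐ : r₄ ≐ (4 , 1) / 2
  r₄≐ = cleared (fromℕ-*-fromℕ 2 2 ≡.refl) (fromℕ-*-frac 2 1 1 1 ≡.refl)

  r₅≐ : r₅ ≐ (2 , 3) / 4
  r₅≐ = cleared (fromℕ-*-frac 4 1 1 2 ≡.refl) (fromℕ-*-frac 4 3 3 3 ≡.refl)

  r₆≐ : r₆ ≐ (2 , 7) / 12
  r₆≐ = cleared (fromℕ-*-frac 12 1 5 2 ≡.refl) (fromℕ-*-frac 12 7 11 7 ≡.refl)

  ∈P₁⇒0≤x : ∀ {x z} → (x , z) ∈ₚ P₁ → 0# ≤ x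
  ∈P₁⇒0≤x = hull-x≥ (≤-reflexive ≈-refl ∷ 0≤1 ∷ frac-nonneg 9 3 ∷ ≤-reflexive ≈-refl ∷ [])

  ∈P₁⇒0≤z : ∀ {x z} → (x , z) ∈ₚ P₁ → 0# ≤ z
  ∈P₁⇒0≤z = hull-z≥ (≤-reflexive ≈-refl ∷ ≤-reflexive ≈-refl ∷ frac-nonneg 1 1 ∷ frac-nonneg 8 6 ∷ [])

  ∈P₁⇒below-top-edge : ∀ {x z} → (x , z) ∈ₚ P₁ → 0# ≤ fromℕ 8 - fromℕ 2 * x - fromℕ 7 * z
  ∈P₁⇒below-top-edge {x} {z} x,z∈P₁ =
    ≲-respʳ-≈ (solve 2 (λ x z → (:- κ 2) :* x :+ (:- κ 7) :* z :+ κ 8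
                            := κ 8 :- κ 2 :* x :- κ 7 :* z) ≈-refl x z)
      (hull-nonneg (vertex 0 0 0 (0# , 0#) (cleared (zeroʳ _) (zeroʳ _)) (ℤ.+≤+ ℕ.z≤n)
                  ∷ vertex 0 1 0 (1# , 0#) (cleared (*-identityʳ _) (zeroʳ _)) (ℤ.+≤+ ℕ.z≤n)
                  ∷ vertex 3 9 2 (frac 9 4 , frac 1 2)
                      (cleared (fromℕ-*-frac 4 9 3 9 ≡.refl) (fromℕ-*-frac 4 1 1 2 ≡.refl)) (ℤ.+≤+ ℕ.z≤n)
                  ∷ vertex 6 0 8 (0# , frac 8 7) (cleared (zeroʳ _) (fromℕ-*-frac 7 8 6 8 ≡.refl)) (ℤ.+≤+ ℕ.z≤n)
                  ∷ []) x,z∈P₁)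
    where
    vertex : ∀ k X Z v → v ≐ (X , Z) / suc k → + 0 ℤ.≤ -[1+ 1 ] ℤ.* + X ℤ.+ -[1+ 6 ] ℤ.* + Z ℤ.+ + suc k ℤ.* + 8 →
             0# ≤ affine (- fromℕ 2) (- fromℕ 7) (fromℕ 8) v
    vertex k X Z = affine-ℤ-nonneg -[1+ 1 ] -[1+ 6 ] (+ 8) {k} {X} {Z}

  -- If a is the largest x-coordinate then r₄ ∈ T gives 2 ≤ a; if u is, 2 ≤ u ≤ 1; if a ≤ u ≤ c the
  -- triangle is clockwise; and if u is the smallest, r₆ ∈ T gives u ≤ 1/6 < 1/2.
  v₂-right-of-r₄ : ∀ {u a b c d} → let T = (u , 0#) ∷ (a , b) ∷ (c , d) ∷ [] in
                   0# ≤ fromℕ 2 * u - fromℕ 1 → 0# ≤ fromℕ 1 - u → 0# ≤ b → 0# ≤ d →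
                   0# ≤ cross (u , 0#) (a , b) (c , d) → ¬ (cross (u , 0#) (a , b) (c , d) ≈ 0#) →
                   r₄ ∈ₚ T → r₆ ∈ₚ T → fromℕ 2 ≤ a
  v₂-right-of-r₄ {u} {a} {b} {c} {d} 0≤2u-1 0≤1-u 0≤b 0≤d 0≤cross cross≉0 r₄∈T r₆∈T
    with total u a
  ... | inj₁ u≤a with total c a
  ...   | inj₁ c≤a = hull-x≤ (u≤a ∷ ≤-reflexive ≈-refl ∷ c≤a ∷ []) r₄∈T
  ...   | inj₂ a≤c = ⊥-elim (-fromℕ-suc≱0 3 (≲-respʳ-≈ r₆-too-far-right
                       (+-nonneg (*-nonneg (fromℕ-nonneg 12) (x≤y⇒0≤y-x u≤r₆)) (*-nonneg (fromℕ-nonneg 6) 0≤2u-1))))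
    where
    u≤r₆ : u ≤ frac 1 6
    u≤r₆ = hull-x≥ (≤-reflexive ≈-refl ∷ u≤a ∷ ≤-trans u≤a a≤c ∷ []) r₆∈T
    r₆-too-far-right : fromℕ 12 * (frac 1 6 - u) + fromℕ 6 * (fromℕ 2 * u - fromℕ 1) ≈ - fromℕ 4
    r₆-too-far-right = begin
      fromℕ 12 * (frac 1 6 - u) + fromℕ 6 * (fromℕ 2 * u - fromℕ 1)
        ≈⟨ solve 2 (λ f u → κ 12 :* (f :- u) :+ κ 6 :* (κ 2 :* u :- κ 1) := κ 12 :* f :- κ 6) ≈-refl (frac 1 6) u ⟩
      fromℕ 12 * frac 1 6 - fromℕ 6  ≈⟨ +-congʳ (x-cleared r₆≐) ⟩
      fromℕ 2 - fromℕ 6              ≈⟨ solve 0 (κ 2 :- κ 6 := :- κ 4) ≈-refl ⟩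
      - fromℕ 4                      ∎
  v₂-right-of-r₄ {u} {a} {b} {c} {d} 0≤2u-1 0≤1-u 0≤b 0≤d 0≤cross cross≉0 r₄∈T r₆∈T
    | inj₂ a≤u with total u c
  ...   | inj₁ u≤c = ⊥-elim (cross≉0 (nonneg∧nonpos⇒≈0 0≤cross (≲-respʳ-≈ -cross≈
                       (+-nonneg (*-nonneg (x≤y⇒0≤y-x a≤u) 0≤d) (*-nonneg 0≤b (x≤y⇒0≤y-x u≤c))))))
    where
    -cross≈ : (u - a) * d + b * (c - u) ≈ - cross (u , 0#) (a , b) (c , d)
    -cross≈ = solve 5 (λ u a b c d → (u :- a) :* d :+ b :* (c :- u)
                                   := :- ((a :- u) :* (d :- κ 0) :- (b :- κ 0) :* (c :- u))) ≈-refl u a b c d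
  ...   | inj₂ c≤u = ⊥-elim (-fromℕ-suc≱0 0
                       (≲-respʳ-≈ (solve 1 (λ u → (u :- κ 2) :+ (κ 1 :- u) := :- κ 1) ≈-refl u)
                                  (+-nonneg (x≤y⇒0≤y-x r₄≤u) 0≤1-u)))
    where
    r₄≤u : fromℕ 2 ≤ u
    r₄≤u = hull-x≤ (≤-reflexive ≈-refl ∷ a≤u ∷ c≤u ∷ []) r₄∈T

  -- φ u a b ≥ 0 says that (0 , 7u/(12u - 2)), where the line q₁r₆ meets the z-axis, lies weakly right
  -- of the line from v₂ = (a , b) through r₅; it is what survives of the constraints on v₃.
  φ : Carrier → Carrier → Carrier → Carrier
  φ u a b = (fromℕ 3 - fromℕ 4 * u) * a + (fromℕ 12 * u - fromℕ 2) * b - fromℕ 7 * u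

  0≤φ : ∀ {u a b c d} → 0# ≤ fromℕ 2 * u - fromℕ 1 → 0# ≤ fromℕ 1 - u → 0# ≤ a - fromℕ 2 → 0# ≤ b → 0# ≤ c →
        LeftOf (a , b) (c , d) r₅ → LeftOf (c , d) (u , 0#) r₆ → 0# ≤ φ u a b
  0≤φ {u} {a} {b} {c} {d} 0≤2u-1 0≤1-u 0≤a-2 0≤b 0≤c r₅-left r₆-left =
    ≲-respʳ-≈ certificate (+-nonneg (+-nonneg (*-nonneg μ₅ H₅) (*-nonneg μ₆ H₆)) (*-nonneg 0≤c μc))
    where
    H₅ : 0# ≤ (c - a) * (fromℕ 3 - fromℕ 4 * b) - (d - b) * (fromℕ 2 - fromℕ 4 * a)
    H₅ = LeftOf-cleared r₅ r₅≐ r₅-left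
    H₆ : 0# ≤ (u - c) * (fromℕ 7 - fromℕ 12 * d) - (0# - d) * (fromℕ 2 - fromℕ 12 * c)
    H₆ = LeftOf-cleared r₆ r₆≐ r₆-left
    μ₅ : 0# ≤ fromℕ 3 * (fromℕ 2 * u - fromℕ 1) + fromℕ 2
    μ₅ = +-nonneg (*-nonneg (fromℕ-nonneg 3) 0≤2u-1) (fromℕ-nonneg 2)
    μ₆ : 0# ≤ fromℕ 2 * (a - fromℕ 2) + fromℕ 3
    μ₆ = +-nonneg (*-nonneg (fromℕ-nonneg 2) 0≤a-2) (fromℕ-nonneg 3)
    μc : 0# ≤ fromℕ 14 * (a - fromℕ 2) + fromℕ 18 * (fromℕ 1 - u) + fromℕ 6
              + (fromℕ 12 * (fromℕ 2 * u - fromℕ 1) + fromℕ 8) * b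
    μc = +-nonneg (+-nonneg (+-nonneg (*-nonneg (fromℕ-nonneg 14) 0≤a-2) (*-nonneg (fromℕ-nonneg 18) 0≤1-u))
                            (fromℕ-nonneg 6))
                  (*-nonneg (+-nonneg (*-nonneg (fromℕ-nonneg 12) 0≤2u-1) (fromℕ-nonneg 8)) 0≤b)
    -- With these multipliers of H₅ and H₆ the terms in d cancel, and the remaining terms in c are
    -- c times a nonpositive quantity, which the third summand removes.
    certificate : (fromℕ 3 * (fromℕ 2 * u - fromℕ 1) + fromℕ 2)
                    * ((c - a) * (fromℕ 3 - fromℕ 4 * b) - (d - b) * (fromℕ 2 - fromℕ 4 * a))
                  + (fromℕ 2 * (a - fromℕ 2) + fromℕ 3)
                    * ((u - c) * (fromℕ 7 - fromℕ 12 * d) - (0# - d) * (fromℕ 2 - fromℕ 12 * c))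
                  + c * (fromℕ 14 * (a - fromℕ 2) + fromℕ 18 * (fromℕ 1 - u) + fromℕ 6
                         + (fromℕ 12 * (fromℕ 2 * u - fromℕ 1) + fromℕ 8) * b)
                  ≈ φ u a b
    certificate = solve 5 (λ u a b c d →
         (κ 3 :* (κ 2 :* u :- κ 1) :+ κ 2) :* ((c :- a) :* (κ 3 :- κ 4 :* b) :- (d :- b) :* (κ 2 :- κ 4 :* a))
      :+ (κ 2 :* (a :- κ 2) :+ κ 3) :* ((u :- c) :* (κ 7 :- κ 12 :* d) :- (κ 0 :- d) :* (κ 2 :- κ 12 :* c))
      :+ c :* (κ 14 :* (a :- κ 2) :+ κ 18 :* (κ 1 :- u) :+ κ 6 :+ (κ 12 :* (κ 2 :* u :- κ 1) :+ κ 8) :* b)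
      := (κ 3 :- κ 4 :* u) :* a :+ (κ 12 :* u :- κ 2) :* b :- κ 7 :* u) ≈-refl u a b c d

  0≤u²-4u+2 : ∀ {u a b} → 0# ≤ fromℕ 2 * u - fromℕ 1 → 0# ≤ fromℕ 1 - u →
              0# ≤ fromℕ 8 - fromℕ 2 * a - fromℕ 7 * b →
              LeftOf (u , 0#) (a , b) r₄ → 0# ≤ φ u a b → 0# ≤ u * u - fromℕ 4 * u + fromℕ 2
  0≤u²-4u+2 {u} {a} {b} 0≤2u-1 0≤1-u 0≤8-2a-7b r₄-left 0≤φu =
    fromℕ-suc-*-cancel 39 (≲-respʳ-≈ certificate
      (+-nonneg (+-nonneg (*-nonneg μφ 0≤φu) (*-nonneg μT 0≤8-2a-7b)) (*-nonneg μ₄ H₄)))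
    where
    H₄ : 0# ≤ (a - u) * (fromℕ 1 - fromℕ 2 * 0#) - (b - 0#) * (fromℕ 4 - fromℕ 2 * u)
    H₄ = LeftOf-cleared r₄ r₄≐ r₄-left
    μφ : 0# ≤ fromℕ 4 * (fromℕ 1 - u) + fromℕ 11
    μφ = +-nonneg (*-nonneg (fromℕ-nonneg 4) 0≤1-u) (fromℕ-nonneg 11)
    μT : 0# ≤ fromℕ 2 * ((fromℕ 2 * u - fromℕ 1) * (fromℕ 2 * u - fromℕ 1)) + fromℕ 2 * (fromℕ 1 - u) + fromℕ 6
    μT = +-nonneg (+-nonneg (*-nonneg (fromℕ-nonneg 2) (*-nonneg 0≤2u-1 0≤2u-1)) (*-nonneg (fromℕ-nonneg 2) 0≤1-u))
                  (fromℕ-nonneg 6)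
    μ₄ : 0# ≤ fromℕ 26 * (fromℕ 2 * u - fromℕ 1) + fromℕ 1
    μ₄ = +-nonneg (*-nonneg (fromℕ-nonneg 26) 0≤2u-1) (fromℕ-nonneg 1)
    -- The three constraints are linear in (a , b); these are their Farkas multipliers.
    certificate : (fromℕ 4 * (fromℕ 1 - u) + fromℕ 11) * φ u a b
                  + (fromℕ 2 * ((fromℕ 2 * u - fromℕ 1) * (fromℕ 2 * u - fromℕ 1)) + fromℕ 2 * (fromℕ 1 - u) + fromℕ 6)
                    * (fromℕ 8 - fromℕ 2 * a - fromℕ 7 * b)
                  + (fromℕ 26 * (fromℕ 2 * u - fromℕ 1) + fromℕ 1)
                    * ((a - u) * (fromℕ 1 - fromℕ 2 * 0#) - (b - 0#) * (fromℕ 4 - fromℕ 2 * u))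
                  ≈ fromℕ 40 * (u * u - fromℕ 4 * u + fromℕ 2)
    certificate = solve 3 (λ u a b →
         (κ 4 :* (κ 1 :- u) :+ κ 11) :* ((κ 3 :- κ 4 :* u) :* a :+ (κ 12 :* u :- κ 2) :* b :- κ 7 :* u)
      :+ (κ 2 :* ((κ 2 :* u :- κ 1) :* (κ 2 :* u :- κ 1)) :+ κ 2 :* (κ 1 :- u) :+ κ 6) :* (κ 8 :- κ 2 :* a :- κ 7 :* b)
      :+ (κ 26 :* (κ 2 :* u :- κ 1) :+ κ 1) :* ((a :- u) :* (κ 1 :- κ 2 :* κ 0) :- (b :- κ 0) :* (κ 4 :- κ 2 :* u))
      := κ 40 :* (u :* u :- κ 4 :* u :+ κ 2)) ≈-refl u a b

  three-vertices⇒0≤u²-4u+2 : ∀ {u} → 0# ≤ fromℕ 2 * u - fromℕ 1 → 0# ≤ fromℕ 1 - u →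
                             SupportingHasThreeVertices R₁ P₁ (u , 0#) → 0# ≤ u * u - fromℕ 4 * u + fromℕ 2
  three-vertices⇒0≤u²-4u+2 {u} 0≤2u-1 0≤1-u
    ((a , b) , (c , d) , anticlockwise , nondegenerate , (R₁⊆T , T⊆P₁)
             , (_ , _ , _ , R₁-left-of-q₁v₂) , (_ , _ , _ , R₁-left-of-v₂v₃)) =
    0≤u²-4u+2 0≤2u-1 0≤1-u (∈P₁⇒below-top-edge v₂∈P₁) (R₁-left-of-q₁v₂ r₄ r₄∈R₁)
      (0≤φ 0≤2u-1 0≤1-u 0≤a-2 (∈P₁⇒0≤z v₂∈P₁) (∈P₁⇒0≤x v₃∈P₁)
           (R₁-left-of-v₂v₃ r₅ r₅∈R₁) (anticlockwise⇒LeftOf-edge₃₁ anticlockwise (R₁⊆T r₆ r₆∈R₁)))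
    where
    r₄∈R₁ : r₄ ∈ₚ R₁
    r₄∈R₁ = ∈⇒∈ₚ (here ≡.refl)
    r₅∈R₁ : r₅ ∈ₚ R₁
    r₅∈R₁ = ∈⇒∈ₚ (there (here ≡.refl))
    r₆∈R₁ : r₆ ∈ₚ R₁
    r₆∈R₁ = ∈⇒∈ₚ (there (there (here ≡.refl)))
    v₂∈P₁ : (a , b) ∈ₚ P₁
    v₂∈P₁ = T⊆P₁ (a , b) (∈⇒∈ₚ (there (here ≡.refl)))
    v₃∈P₁ : (c , d) ∈ₚ P₁
    v₃∈P₁ = T⊆P₁ (c , d) (∈⇒∈ₚ (there (there (here ≡.refl))))
    0≤a-2 : 0# ≤ a - fromℕ 2
    0≤a-2 = x≤y⇒0≤y-x (v₂-right-of-r₄ 0≤2u-1 0≤1-u (∈P₁⇒0≤z v₂∈P₁) (∈P₁⇒0≤z v₃∈P₁)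
                                      anticlockwise nondegenerate (R₁⊆T r₄ r₄∈R₁) (R₁⊆T r₆ r₆∈R₁))

-- The hypothesis 0 ≤ u is not needed: in the case that matters u ≥ 1/2.
lemma4p2 : (F : RealField) (u : RealField.Carrier F) →
    let open RealField F in
    let open Geometry F in
    0# ≤ u → u ≤ 1# →
    SupportingHasThreeVertices R₁ P₁ (u , 0#) →
    ∀ (s : Carrier) → 0# ≤ s → s * s ≈ fromℕ 2 →   -- s = √2
    u ≤ fromℕ 2 - s
lemma4p2 F u _ u≤1 three-vertices s 0≤s s²≈2 =
  [ (λ 2u≤1 → 2u≤1⇒u≤2-√2 0≤s s²≈2 (x≤y⇒0≤y-x 2u≤1))
  , (λ 1≤2u → u²-4u+2≥0⇒u≤2-√2 0≤s s²≈2 0≤1-u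
                 (three-vertices⇒0≤u²-4u+2 (x≤y⇒0≤y-x 1≤2u) 0≤1-u three-vertices))
  ]′ (total (fromℕ 2 * u) (fromℕ 1))
  where
  open SupportingTriangle F
  open RealFieldProperties F
  0≤1-u : 0# ≤ fromℕ 1 - u
  0≤1-u = ≲-respʳ-≈ (+-congʳ (≈-sym (+-identityʳ 1#))) (x≤y⇒0≤y-x u≤1)
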